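{- Let $a,e\ge1$ be integers and $K$ a finite algorithm such that for every board $M'$ with no vertical edges removed, the robot starting at $(0,0)$ and following $K$ in $M'$ ends at a point of the $x$-axis with non-negative longitude. Let $M$ be a board with no vertical edges removed and let $0\le l\le e-2$ be an integer such that: (1) for every $0\le x\le l$ the columns $c_x$ and $c_{x+1}$ are joined in $M$ at some latitude between $-a$ and $a$; (2) for every $x_v$ with $0\le x_v\le l$, the robot starting at $(x_v,0)$ and following $K$ in $M$ ends at some point $(x_w,0)$ with $x_v\le x_w\le l$ without visiting any point of longitude at least $l+1$. Then the robot starting at $(0,0)$ and following $SME(a,e,K)$ in $M$ ends at some point $(x_v,0)$ with $x_v\ge l+1$. Moreover, the first move of the robot from column $c_l$ to column $c_{l+1}$ does not occur while executing a copy of $K$; it occurs while executing a locomotory move $N^mES^m$, where $m$ is the least element, with respect to the well order $0<1<-1<2<-2<\cdots$ on $\mathbb{Z}$, of the set of latitudes at which $c_l$ and $c_{l+1}$ are joined in $M$; and the instructions executed immediately after this locomotory move form a copy of $K$.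
   Context: A board is a spanning subgraph $M$ of the graph $\mathbb{Z}^2$; each edge is traversable in both directions, and the directed edge from $(x,y)$ to $(x,y+1)$, $(x,y-1)$, $(x+1,y)$, $(x-1,y)$ has colour $N$, $S$, $E$, $W$. An algorithm is a sequence of instructions from $\{N,S,E,W\}$; concatenation is written as multiplication and powers denote repetition. A robot at $v$ executing instruction $I$ moves along the edge of colour $I$ leaving $v$ if present in the board, otherwise stays at $v$. For a point $(x,y)$, $x$ is its longitude and $y$ its latitude; $c_i=\{(i,y):y\in\mathbb{Z}\}$ is the $i$-th column; columns $c_i$ and $c_{i+1}$ are joined at latitude $j$ if the edge between $(i,j)$ and $(i+1,j)$ is present. For an integer $k$, $N^kES^k$ with $k<0$ means $S^{ -k}EN^{ -k}$. The locomotory moves are $M_0=E$, $M_1=NES$, $M_2=SEN$, $M_3=N^2ES^2$, $M_4=S^2EN^2$, $\dots$, $M_{2a-1}=N^aES^a$, $M_{2a}=S^aEN^a$. Define $U_{ -1}=K$, $U_j=(U_{j-1})^eM_j$ for $0\le j\le 2a$, and $SME(a,e,K)=(U_{2a})^e$, i.e. $SME(a,e,K)=(((((K^eE)^eNES)^eSEN)^eN^2ES^2)^e\cdots S^aEN^a)^e$. -}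

module Defs where

open import Data.Bool using (Bool; true; false; if_then_else_)
open import Data.Nat as ℕ using (ℕ; zero; suc)
open import Data.Integer as ℤ using (ℤ; +_; -[1+_]; _+_; _-_; 0ℤ; 1ℤ)
open import Data.Product using (_×_; _,_; proj₁; proj₂)
open import Data.List using (List; []; _∷_; _++_; replicate; concat; concatMap; map)
open import Data.Maybe using (Maybe; just; nothing)
open import Relation.Binary.PropositionalEquality using (_≡_)

-- Points of ℤ²: (longitude , latitude)
Pos : Set
Pos = ℤ × ℤ

-- A board: a spanning subgraph of ℤ².
--   hor x y = true  iff the edge (x,y)–(x+1,y) is present
--   ver x y = true  iff the edge (x,y)–(x,y+1) is present
record Board : Set where
  field
    hor : ℤ → ℤ → Bool
    ver : ℤ → ℤ → Bool
open Board public

NoVerticalRemoved : Board → Set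
NoVerticalRemoved B = ∀ x y → ver B x y ≡ true

data Instr : Set where
  N S E W : Instr

Algorithm : Set
Algorithm = List Instr

step : Board → Pos → Instr → Pos
step B (x , y) N = if ver B x y then (x , y + 1ℤ) else (x , y)
step B (x , y) S = if ver B x (y - 1ℤ) then (x , y - 1ℤ) else (x , y)
step B (x , y) E = if hor B x y then (x + 1ℤ , y) else (x , y)
step B (x , y) W = if hor B (x - 1ℤ) y then (x - 1ℤ , y) else (x , y)

run : Board → Pos → Algorithm → Pos
run B p []       = p
run B p (i ∷ is) = run B (step B p i) is

visited : Board → Pos → Algorithm → List Pos
visited B p []       = p ∷ []
visited B p (i ∷ is) = p ∷ visited B (step B p i) is

NkESk : ℤ → Algorithm
NkESk (+ n)     = replicate n N ++ E ∷ replicate n S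
NkESk -[1+ n ]  = replicate (suc n) S ++ E ∷ replicate (suc n) N

-- locomotory moves: M_0 = E, M_{2b-1} = N^b E S^b, M_{2b} = S^b E N^b
Mloc' : ℕ → ℕ → Algorithm
Mloc' zero          b = NkESk (+ suc b)
Mloc' (suc zero)    b = NkESk -[1+ b ]
Mloc' (suc (suc n)) b = Mloc' n (suc b)

Mloc : ℕ → Algorithm
Mloc zero    = E ∷ []
Mloc (suc n) = Mloc' n 0

data Block : Set where
  copyK : Block
  loco  : ℕ → Block

-- UB e (suc j) is the block structure of U_j; UB e 0 that of U_{-1} = K
UB : ℕ → ℕ → List Block
UB e zero    = copyK ∷ []
UB e (suc j) = concat (replicate e (UB e j)) ++ loco j ∷ []

-- block structure of SME(a,e,K) = (U_{2a})^e
SMEBlocks : ℕ → ℕ → List Block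
SMEBlocks a e = concat (replicate e (UB e (suc (2 ℕ.* a))))

expand : Algorithm → Block → Algorithm
expand K copyK    = K
expand K (loco j) = Mloc j

SME : ℕ → ℕ → Algorithm → Algorithm
SME a e K = concatMap (expand K) (SMEBlocks a e)

tagged : Algorithm → ℕ → List Block → List (ℕ × Instr)
tagged K i []       = []
tagged K i (b ∷ bs) = map (λ ins → (i , ins)) (expand K b) ++ tagged K (suc i) bs

-- executed steps: (block index , position before , position after)
Step : Set
Step = ℕ × Pos × Pos

steps : Board → Pos → List (ℕ × Instr) → List Step
steps B p []             = []
steps B p ((i , ins) ∷ r) = (i , p , step B p ins) ∷ steps B (step B p ins) r

Crosses : ℤ → Step → Set
Crosses l (i , p , q) = proj₁ p ≡ l × proj₁ q ≡ l + 1ℤ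

nth : {A : Set} → List A → ℕ → Maybe A
nth []       _       = nothing
nth (x ∷ xs) zero    = just x
nth (x ∷ xs) (suc n) = nth xs n

-- the well order 0 < 1 < -1 < 2 < -2 < ⋯ on ℤ, via its rank
rank : ℤ → ℕ
rank (+ zero)    = 0
rank (+ suc n)   = suc (2 ℕ.* n)
rank -[1+ n ]    = 2 ℕ.+ 2 ℕ.* n

_≺=_ : ℤ → ℤ → Set
m ≺= n = rank m ℕ.≤ rank n

LeastJoin : Board → ℤ → ℤ → Set
LeastJoin B l m = (hor B l m ≡ true) × (∀ y → hor B l y ≡ true → m ≺= y)

module Submission where

-- Between blocks the robot is on the x-axis, so until it passes column l its progress is a
-- monotone map on columns: K moves x to some x' ≥ x with x' ≤ l, and M_j moves x to x + 1
-- exactly when c_x and c_{x+1} are joined at the j-th latitude of the order 0, 1, -1, 2, ….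
-- A column fixed by U_j is joined at no latitude of rank < j. In U_{j+1} = U_j^e M_j the
-- e ≥ l + 2 copies of U_j cannot all advance without passing l, so some copy fixes the
-- column; hence when M_j first carries the robot from c_l to c_{l+1}, j is the least join,
-- and the crossing never ends a sequence of copies, so a copy of K follows it. At the top
-- level a column ≤ l fixed by U_{2a} would contradict condition (1), so the crossing does
-- happen. Before it, K stays in columns ≤ l and each M_j moves vertically in columns ≤ l,
-- so no earlier step crosses.

open import Defs
open import Data.Bool using (Bool; true; false)
open import Data.Nat using (ℕ; zero; suc; _≤_)
open import Data.Integer using (ℤ; +_; -_; 0ℤ; 1ℤ) renaming (_≤_ to _≤ℤ_; _+_ to _+ℤ_)
open import Data.Product using (Σ; ∃; ∃-syntax; _×_; _,_; proj₁; proj₂)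
open import Data.List using (List; []; _∷_; _++_)
open import Data.List.Relation.Unary.All using (All)
open import Data.Maybe using (just)
open import Relation.Nullary using (¬_)
open import Relation.Binary.PropositionalEquality using (_≡_)

open import Data.Bool using (if_then_else_)
open import Data.Empty using (⊥-elim)
open import Data.Unit using (⊤; tt)
open import Data.Nat as ℕ using (_<_; z≤n; s≤s)
import Data.Nat.Properties as ℕP
open import Data.Integer using (-[1+_]; +≤+; -≤-) renaming (_-_ to _-ℤ_)
import Data.Integer.Properties as ℤP
open import Algebra.Properties.CommutativeSemigroup ℤP.+-commutativeSemigroup using (xy∙z≈xz∙y)
open import Data.Product using (∃₂)
open import Data.Product.Properties using (,-injectiveˡ)
open import Data.Sum using (_⊎_; inj₁; inj₂)
open import Data.List using ([_]; replicate; concat; concatMap; map; length; foldl)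
import Data.List.Properties as ListP
open import Data.List.Relation.Unary.All using ([]; _∷_) renaming (map to All-map)
open import Data.List.Relation.Unary.All.Properties using (++⁺)
open import Relation.Binary.PropositionalEquality using (refl; sym; trans; cong; cong₂; subst; module ≡-Reasoning)

latitude' : ℕ → ℕ → ℤ
latitude' zero          b = + suc b
latitude' (suc zero)    b = -[1+ b ]
latitude' (suc (suc n)) b = latitude' n (suc b)

latitude : ℕ → ℤ
latitude zero    = 0ℤ
latitude (suc n) = latitude' n 0

Mloc'≡NkESk : ∀ n b → Mloc' n b ≡ NkESk (latitude' n b)
Mloc'≡NkESk zero          b = refl
Mloc'≡NkESk (suc zero)    b = refl
Mloc'≡NkESk (suc (suc n)) b = Mloc'≡NkESk n (suc b)

Mloc≡NkESk : ∀ j → Mloc j ≡ NkESk (latitude j)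
Mloc≡NkESk zero    = refl
Mloc≡NkESk (suc n) = Mloc'≡NkESk n 0

+-2*suc : ∀ n b → n ℕ.+ 2 ℕ.* suc b ≡ suc (suc (n ℕ.+ 2 ℕ.* b))
+-2*suc n b = begin
  n ℕ.+ 2 ℕ.* suc b          ≡⟨ cong (n ℕ.+_) (ℕP.*-suc 2 b) ⟩
  n ℕ.+ suc (suc (2 ℕ.* b))  ≡⟨ ℕP.+-suc n _ ⟩
  suc (n ℕ.+ suc (2 ℕ.* b))  ≡⟨ cong suc (ℕP.+-suc n _) ⟩
  suc (suc (n ℕ.+ 2 ℕ.* b))  ∎
  where open ≡-Reasoning

rank-latitude' : ∀ n b → rank (latitude' n b) ≡ suc (n ℕ.+ 2 ℕ.* b)
rank-latitude' zero          b = refl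
rank-latitude' (suc zero)    b = refl
rank-latitude' (suc (suc n)) b = trans (rank-latitude' n (suc b)) (cong suc (+-2*suc n b))

rank-latitude : ∀ j → rank (latitude j) ≡ j
rank-latitude zero    = refl
rank-latitude (suc n) = trans (rank-latitude' n 0) (cong suc (ℕP.+-identityʳ n))

latitude'-+2* : ∀ k n b → latitude' (k ℕ.+ 2 ℕ.* n) b ≡ latitude' k (n ℕ.+ b)
latitude'-+2* k zero    b = cong (λ i → latitude' i b) (ℕP.+-identityʳ k)
latitude'-+2* k (suc n) b = begin
  latitude' (k ℕ.+ 2 ℕ.* suc n) b  ≡⟨ cong (λ i → latitude' i b) (+-2*suc k n) ⟩
  latitude' (k ℕ.+ 2 ℕ.* n) (suc b) ≡⟨ latitude'-+2* k n (suc b) ⟩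
  latitude' k (n ℕ.+ suc b)         ≡⟨ cong (latitude' k) (ℕP.+-suc n b) ⟩
  latitude' k (suc n ℕ.+ b)         ∎
  where open ≡-Reasoning

latitude-rank : ∀ y → latitude (rank y) ≡ y
latitude-rank (+ zero)  = refl
latitude-rank (+ suc n) = trans (latitude'-+2* 0 n 0) (cong (λ i → + suc i) (ℕP.+-identityʳ n))
latitude-rank -[1+ n ]  = trans (latitude'-+2* 1 n 0) (cong -[1+_] (ℕP.+-identityʳ n))

rank-≤ : ∀ a y → - (+ a) ≤ℤ y → y ≤ℤ + a → rank y ≤ 2 ℕ.* a
rank-≤ a (+ zero)  _ _ = z≤n
rank-≤ a (+ suc n) _ (+≤+ n<a) =
  ℕP.≤-trans (ℕP.n≤1+n _) (subst (_≤ 2 ℕ.* a) (+-2*suc 0 n) (ℕP.*-monoʳ-≤ 2 n<a))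
rank-≤ zero    -[1+ n ] () _
rank-≤ (suc a) -[1+ n ] (-≤- n≤a) _ =
  subst (_≤ 2 ℕ.* suc a) (+-2*suc 0 n) (ℕP.*-monoʳ-≤ 2 (s≤s n≤a))

IsLeast : (ℕ → Bool) → ℕ → Set
IsLeast P r = P r ≡ true × (∀ k → k < r → P k ≡ false)

least-exists : ∀ P n → P n ≡ true → ∃ (IsLeast P)
least-exists P zero    Pn = zero , Pn , λ _ ()
least-exists P (suc n) Pn with P 0 in P0
... | true  = zero , P0 , λ _ ()
... | false with least-exists (λ k → P (suc k)) n Pn
...   | r , Pr , below = suc r , Pr , λ { zero _ → P0 ; (suc k) (s≤s k<r) → below k k<r }

IsLeast⇒≤ : ∀ {P r k} → IsLeast P r → P k ≡ true → r ≤ k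
IsLeast⇒≤ {k = k} (_ , below) Pk = ℕP.≮⇒≥ k≮r
  where
  k≮r : ¬ k < _
  k≮r k<r with trans (sym Pk) (below k k<r)
  ... | ()

least-unique : ∀ {P r s} → IsLeast P r → IsLeast P s → r ≡ s
least-unique r-least s-least =
  ℕP.≤-antisym (IsLeast⇒≤ r-least (proj₁ s-least)) (IsLeast⇒≤ s-least (proj₁ r-least))

nth-++ʳ : ∀ {A : Set} (xs ys : List A) k → nth (xs ++ ys) (k ℕ.+ length xs) ≡ nth ys k
nth-++ʳ []       ys k rewrite ℕP.+-identityʳ k = refl
nth-++ʳ (x ∷ xs) ys k rewrite ℕP.+-suc k (length xs) = nth-++ʳ xs ys k

copies : ℕ → List Block → List Block
copies n X = concat (replicate n X)

UB-head : ∀ {e} → 1 ≤ e → ∀ j → ∃[ X ] UB e j ≡ copyK ∷ X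
UB-head _ zero = [] , refl
UB-head {suc n} 1≤e (suc j) with UB-head 1≤e j
... | X , eq = (X ++ copies n (UB (suc n) j)) ++ [ loco j ] ,
               cong (λ Z → (Z ++ copies n (UB (suc n) j)) ++ [ loco j ]) eq

tag : ℕ → Algorithm → List (ℕ × Instr)
tag i = map (i ,_)

arrival : Step → Pos
arrival (_ , _ , q) = q

run-++ : ∀ B p xs ys → run B p (xs ++ ys) ≡ run B (run B p xs) ys
run-++ B p []       ys = refl
run-++ B p (i ∷ xs) ys = run-++ B (step B p i) xs ys

steps-++ : ∀ B p xs ys → steps B p (xs ++ ys) ≡ steps B p xs ++ steps B (run B p (map proj₂ xs)) ys
steps-++ B p []               ys = refl
steps-++ B p ((i , ins) ∷ xs) ys = cong ((i , p , step B p ins) ∷_) (steps-++ B (step B p ins) xs ys)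

map-proj₂-tag : ∀ i is → map proj₂ (tag i is) ≡ is
map-proj₂-tag i is = trans (sym (ListP.map-∘ is)) (ListP.map-id is)

map-proj₂-tagged : ∀ K i bs → map proj₂ (tagged K i bs) ≡ concatMap (expand K) bs
map-proj₂-tagged K i []       = refl
map-proj₂-tagged K i (b ∷ bs) = trans (ListP.map-++ proj₂ (tag i (expand K b)) (tagged K (suc i) bs))
  (cong₂ _++_ (map-proj₂-tag i (expand K b)) (map-proj₂-tagged K (suc i) bs))

tagged-++ : ∀ K i xs ys → tagged K i (xs ++ ys) ≡ tagged K i xs ++ tagged K (i ℕ.+ length xs) ys
tagged-++ K i []       ys rewrite ℕP.+-identityʳ i = refl
tagged-++ K i (b ∷ xs) ys rewrite tagged-++ K (suc i) xs ys | ℕP.+-suc i (length xs) =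
  sym (ListP.++-assoc (tag i (expand K b)) (tagged K (suc i) xs) _)

visited-head : ∀ B {P : Pos → Set} p is → All P (visited B p is) → P p
visited-head B p []      (Pp ∷ _) = Pp
visited-head B p (_ ∷ _) (Pp ∷ _) = Pp

steps-visited : ∀ B {P : Pos → Set} i p is → All P (visited B p is) →
                All (λ t → P (arrival t)) (steps B p (tag i is))
steps-visited B i p []         _          = []
steps-visited B i p (ins ∷ is) (_ ∷ rest) =
  visited-head B (step B p ins) is rest ∷ steps-visited B i (step B p ins) is rest

ArrivesIn : ℤ → Step → Set
ArrivesIn X t = proj₁ (arrival t) ≡ X

step-N-longitude : ∀ B p → proj₁ (step B p N) ≡ proj₁ p
step-N-longitude B (x , y) with ver B x y
... | true  = refl
... | false = refl

step-S-longitude : ∀ B p → proj₁ (step B p S) ≡ proj₁ p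
step-S-longitude B (x , y) with ver B x (y -ℤ 1ℤ)
... | true  = refl
... | false = refl

steps-replicate-column : ∀ B d → (∀ p → proj₁ (step B p d) ≡ proj₁ p) →
  ∀ i n p → All (ArrivesIn (proj₁ p)) (steps B p (tag i (replicate n d)))
steps-replicate-column B d keeps i zero    p = []
steps-replicate-column B d keeps i (suc n) p = keeps p ∷
  subst (λ X → All (ArrivesIn X) (steps B (step B p d) (tag i (replicate n d)))) (keeps p)
        (steps-replicate-column B d keeps i n (step B p d))

run-replicate-N : ∀ B → NoVerticalRemoved B → ∀ n X y → run B (X , y) (replicate n N) ≡ (X , y +ℤ + n)
run-replicate-N B nv zero    X y = cong (X ,_) (sym (ℤP.+-identityʳ y))
run-replicate-N B nv (suc n) X y rewrite nv X y =
  trans (run-replicate-N B nv n X (y +ℤ 1ℤ)) (cong (X ,_) (ℤP.+-assoc y 1ℤ (+ n)))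

run-replicate-S : ∀ B → NoVerticalRemoved B → ∀ n X y → run B (X , y) (replicate n S) ≡ (X , y -ℤ + n)
run-replicate-S B nv zero    X y = cong (X ,_) (sym (ℤP.+-identityʳ y))
run-replicate-S B nv (suc n) X y rewrite nv X (y -ℤ 1ℤ) =
  trans (run-replicate-S B nv n X (y -ℤ 1ℤ))
        (cong (X ,_) (trans (ℤP.+-assoc y (- 1ℤ) (- + n)) (cong (y +ℤ_) (sym (ℤP.neg-distrib-+ 1ℤ (+ n))))))

east : Board → ℕ → ℤ → ℕ
east B x y = if hor B (+ x) y then suc x else x

step-E : ∀ B x y → step B (+ x , y) E ≡ (+ east B x y , y)
step-E B x y with hor B (+ x) y
... | true  = cong (λ n → (+ n , y)) (ℕP.+-comm x 1)
... | false = refl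

toLatitude : ℤ → Algorithm
toLatitude (+ n)    = replicate n N
toLatitude -[1+ n ] = replicate (suc n) S

fromLatitude : ℤ → Algorithm
fromLatitude (+ n)    = replicate n S
fromLatitude -[1+ n ] = replicate (suc n) N

NkESk≡to-E-from : ∀ m → NkESk m ≡ toLatitude m ++ E ∷ fromLatitude m
NkESk≡to-E-from (+ n)    = refl
NkESk≡to-E-from -[1+ n ] = refl

run-toLatitude : ∀ B → NoVerticalRemoved B → ∀ m X → run B (X , 0ℤ) (toLatitude m) ≡ (X , m)
run-toLatitude B nv (+ n)    X = run-replicate-N B nv n X 0ℤ
run-toLatitude B nv -[1+ n ] X = run-replicate-S B nv (suc n) X 0ℤ

run-fromLatitude : ∀ B → NoVerticalRemoved B → ∀ m X → run B (X , m) (fromLatitude m) ≡ (X , 0ℤ)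
run-fromLatitude B nv (+ n)    X =
  trans (run-replicate-S B nv n X (+ n)) (cong (X ,_) (ℤP.+-inverseʳ (+ n)))
run-fromLatitude B nv -[1+ n ] X =
  trans (run-replicate-N B nv (suc n) X -[1+ n ]) (cong (X ,_) (ℤP.+-inverseˡ (+ suc n)))

toLatitude-column : ∀ B i m p → All (ArrivesIn (proj₁ p)) (steps B p (tag i (toLatitude m)))
toLatitude-column B i (+ n)    = steps-replicate-column B N (step-N-longitude B) i n
toLatitude-column B i -[1+ n ] = steps-replicate-column B S (step-S-longitude B) i (suc n)

fromLatitude-column : ∀ B i m p → All (ArrivesIn (proj₁ p)) (steps B p (tag i (fromLatitude m)))
fromLatitude-column B i (+ n)    = steps-replicate-column B S (step-S-longitude B) i n
fromLatitude-column B i -[1+ n ] = steps-replicate-column B N (step-N-longitude B) i (suc n)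

run-NkESk : ∀ B → NoVerticalRemoved B → ∀ m x → run B (+ x , 0ℤ) (NkESk m) ≡ (+ east B x m , 0ℤ)
run-NkESk B nv m x = begin
  run B (+ x , 0ℤ) (NkESk m)
    ≡⟨ cong (run B (+ x , 0ℤ)) (NkESk≡to-E-from m) ⟩
  run B (+ x , 0ℤ) (toLatitude m ++ E ∷ fromLatitude m)
    ≡⟨ run-++ B (+ x , 0ℤ) (toLatitude m) (E ∷ fromLatitude m) ⟩
  run B (run B (+ x , 0ℤ) (toLatitude m)) (E ∷ fromLatitude m)
    ≡⟨ cong (λ p → run B p (E ∷ fromLatitude m)) (run-toLatitude B nv m (+ x)) ⟩
  run B (step B (+ x , m) E) (fromLatitude m)
    ≡⟨ cong (λ p → run B p (fromLatitude m)) (step-E B x m) ⟩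
  run B (+ east B x m , m) (fromLatitude m)
    ≡⟨ run-fromLatitude B nv m (+ east B x m) ⟩
  (+ east B x m , 0ℤ) ∎
  where open ≡-Reasoning

steps-NkESk : ∀ B → NoVerticalRemoved B → ∀ i m x →
  steps B (+ x , 0ℤ) (tag i (NkESk m)) ≡
    steps B (+ x , 0ℤ) (tag i (toLatitude m))
      ++ (i , (+ x , m) , (+ east B x m , m)) ∷ steps B (+ east B x m , m) (tag i (fromLatitude m))
steps-NkESk B nv i m x = begin
  steps B (+ x , 0ℤ) (tag i (NkESk m))
    ≡⟨ cong (λ is → steps B (+ x , 0ℤ) (tag i is)) (NkESk≡to-E-from m) ⟩
  steps B (+ x , 0ℤ) (tag i (toLatitude m ++ E ∷ fromLatitude m))
    ≡⟨ cong (steps B (+ x , 0ℤ)) (ListP.map-++ (i ,_) (toLatitude m) (E ∷ fromLatitude m)) ⟩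
  steps B (+ x , 0ℤ) (tag i (toLatitude m) ++ tag i (E ∷ fromLatitude m))
    ≡⟨ steps-++ B (+ x , 0ℤ) (tag i (toLatitude m)) (tag i (E ∷ fromLatitude m)) ⟩
  to ++ steps B (run B (+ x , 0ℤ) (map proj₂ (tag i (toLatitude m)))) (tag i (E ∷ fromLatitude m))
    ≡⟨ cong (λ p → to ++ steps B p (tag i (E ∷ fromLatitude m))) at-latitude ⟩
  to ++ (i , (+ x , m) , step B (+ x , m) E) ∷ steps B (step B (+ x , m) E) (tag i (fromLatitude m))
    ≡⟨ cong (λ q → to ++ (i , (+ x , m) , q) ∷ steps B q (tag i (fromLatitude m))) (step-E B x m) ⟩
  to ++ (i , (+ x , m) , (+ east B x m , m)) ∷ steps B (+ east B x m , m) (tag i (fromLatitude m)) ∎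
  where
  open ≡-Reasoning
  to = steps B (+ x , 0ℤ) (tag i (toLatitude m))
  at-latitude : run B (+ x , 0ℤ) (map proj₂ (tag i (toLatitude m))) ≡ (+ x , m)
  at-latitude = trans (cong (run B (+ x , 0ℤ)) (map-proj₂-tag i (toLatitude m))) (run-toLatitude B nv m (+ x))

shiftBoard : ℤ → Board → Board
shiftBoard X B = record { hor = λ u y → hor B (u +ℤ X) y ; ver = λ u y → ver B (u +ℤ X) y }

shift : ℤ → Pos → Pos
shift X (u , y) = (u +ℤ X , y)

step-shift : ∀ B X p ins → step B (shift X p) ins ≡ shift X (step (shiftBoard X B) p ins)
step-shift B X (u , y) N with ver B (u +ℤ X) y
... | true  = refl
... | false = refl
step-shift B X (u , y) S with ver B (u +ℤ X) (y -ℤ 1ℤ)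
... | true  = refl
... | false = refl
step-shift B X (u , y) E with hor B (u +ℤ X) y
... | true  = cong (_, y) (xy∙z≈xz∙y u X 1ℤ)
... | false = refl
step-shift B X (u , y) W rewrite xy∙z≈xz∙y u X (- 1ℤ) with hor B ((u -ℤ 1ℤ) +ℤ X) y
... | true  = refl
... | false = refl

run-shift : ∀ B X p is → run B (shift X p) is ≡ shift X (run (shiftBoard X B) p is)
run-shift B X p []         = refl
run-shift B X p (ins ∷ is) =
  trans (cong (λ q → run B q is) (step-shift B X p ins)) (run-shift B X (step (shiftBoard X B) p ins) is)

-- Every block starts and ends on the x-axis, so a run of blocks is tracked by the column
-- alone: a copy of K takes column x to kstep x, and M_j takes x to x + 1 exactly when
-- c_x and c_{x+1} are joined at the j-th latitude.
module Dynamics (kstep : ℕ → ℕ) (kstep-inflationary : ∀ x → x ≤ kstep x)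
                (joined : ℕ → ℕ → Bool) where

  move : ℕ → Block → ℕ
  move x copyK    = kstep x
  move x (loco j) = if joined x j then suc x else x

  final : ℕ → List Block → ℕ
  final = foldl move

  move-joined : ∀ {x j} → joined x j ≡ true → move x (loco j) ≡ suc x
  move-joined joined-xj rewrite joined-xj = refl

  move-unjoined : ∀ {x j} → joined x j ≡ false → move x (loco j) ≡ x
  move-unjoined unjoined-xj rewrite unjoined-xj = refl

  move-fixed⇒unjoined : ∀ {x j} → move x (loco j) ≡ x → joined x j ≡ false
  move-fixed⇒unjoined {x} {j} fixed with joined x j
  ... | true  = ⊥-elim (ℕP.1+n≢n fixed)
  ... | false = refl

  move-inflationary : ∀ x b → x ≤ move x b
  move-inflationary x copyK    = kstep-inflationary x
  move-inflationary x (loco j) with joined x j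
  ... | true  = ℕP.n≤1+n x
  ... | false = ℕP.≤-refl

  final-inflationary : ∀ x bs → x ≤ final x bs
  final-inflationary x []       = ℕP.≤-refl
  final-inflationary x (b ∷ bs) = ℕP.≤-trans (move-inflationary x b) (final-inflationary (move x b) bs)

  final-++ : ∀ x xs ys → final x (xs ++ ys) ≡ final (final x xs) ys
  final-++ = ListP.foldl-++ move

  final-prefix : ∀ x xs ys → final x xs ≤ final x (xs ++ ys)
  final-prefix x xs ys = subst (final x xs ≤_) (sym (final-++ x xs ys)) (final-inflationary _ ys)

  final-crossing : ∀ {x l r} P Q → final x P ≡ l → joined l r ≡ true → suc l ≤ final x (P ++ loco r ∷ Q)
  final-crossing {x} {l} {r} P Q at joined-lr = begin
    suc l                               ≡⟨ sym (move-joined {l} {r} joined-lr) ⟩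
    move l (loco r)                     ≡⟨ cong (λ z → move z (loco r)) (sym at) ⟩
    move (final x P) (loco r)           ≤⟨ final-inflationary _ Q ⟩
    final (final x P) (loco r ∷ Q)      ≡⟨ sym (final-++ x P (loco r ∷ Q)) ⟩
    final x (P ++ loco r ∷ Q)           ∎
    where open ℕP.≤-Reasoning

  final-copies-fixed : ∀ X z → final z X ≡ z → ∀ n → final z (copies n X) ≡ z
  final-copies-fixed X z fixed zero    = refl
  final-copies-fixed X z fixed (suc n) = begin
    final z (X ++ copies n X)        ≡⟨ final-++ z X (copies n X) ⟩
    final (final z X) (copies n X)   ≡⟨ cong (λ w → final w (copies n X)) fixed ⟩
    final z (copies n X)             ≡⟨ final-copies-fixed X z fixed n ⟩
    z                                ∎
    where open ≡-Reasoning

  final-copies-suc : ∀ X x n → final x (copies (suc n) X) ≡ final (final x (copies n X)) X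
  final-copies-suc X x zero    = final-++ x X []
  final-copies-suc X x (suc n) = begin
    final x (X ++ copies (suc n) X)         ≡⟨ final-++ x X (copies (suc n) X) ⟩
    final (final x X) (copies (suc n) X)    ≡⟨ final-copies-suc X (final x X) n ⟩
    final (final (final x X) (copies n X)) X ≡⟨ cong (λ w → final w X) (sym (final-++ x X (copies n X))) ⟩
    final (final x (X ++ copies n X)) X     ∎
    where open ≡-Reasoning

  copies-fixed-suc : ∀ X x n → final (final x (copies n X)) X ≡ final x (copies n X) →
    final (final x (copies (suc n) X)) X ≡ final x (copies (suc n) X)
  copies-fixed-suc X x n fixed = trans (cong (λ w → final w X) next≡) (trans fixed (sym next≡))
    where
    next≡ : final x (copies (suc n) X) ≡ final x (copies n X)
    next≡ = trans (final-copies-suc X x n) fixed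

  copies-climb-or-fixed : ∀ X x n →
    x ℕ.+ n ≤ final x (copies n X) ⊎ final (final x (copies n X)) X ≡ final x (copies n X)
  copies-climb-or-fixed X x zero = inj₁ (ℕP.≤-reflexive (ℕP.+-identityʳ x))
  copies-climb-or-fixed X x (suc n) with copies-climb-or-fixed X x n
  ... | inj₂ fixed = inj₂ (copies-fixed-suc X x n fixed)
  ... | inj₁ climbed with ℕP.m≤n⇒m<n∨m≡n (final-inflationary (final x (copies n X)) X)
  ...   | inj₂ stalled  = inj₂ (copies-fixed-suc X x n (sym stalled))
  ...   | inj₁ advanced = inj₁ (begin
    x ℕ.+ suc n                                ≡⟨ ℕP.+-suc x n ⟩
    suc (x ℕ.+ n)                              ≤⟨ s≤s climbed ⟩
    suc (final x (copies n X))                 ≤⟨ advanced ⟩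
    final (final x (copies n X)) X             ≡⟨ sym (final-copies-suc X x n) ⟩
    final x (copies (suc n) X)                 ∎)
    where open ℕP.≤-Reasoning

  fixed⇒unjoined : ∀ {e} → 1 ≤ e → ∀ j x → final x (UB e j) ≡ x →
                   ∀ i → i < j → joined x i ≡ false
  fixed⇒unjoined {suc n} 1≤e (suc j) x fixed i (s≤s i≤j) with ℕP.m≤n⇒m<n∨m≡n i≤j
  ... | inj₁ i<j  = fixed⇒unjoined 1≤e j x X-fixes-x i i<j
    where
    X : List Block
    X = UB (suc n) j
    y : ℕ
    y = final x (copies (suc n) X)
    y≤x : y ≤ x
    y≤x = subst (y ≤_) (trans (sym (final-++ x (copies (suc n) X) [ loco j ])) fixed)
                (move-inflationary y (loco j))
    X-fixes-x : final x X ≡ x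
    X-fixes-x = ℕP.≤-antisym (ℕP.≤-trans (final-prefix x X (copies n X)) y≤x) (final-inflationary x X)
  ... | inj₂ refl = move-fixed⇒unjoined (trans (cong (λ w → move w (loco j)) (sym y≡x)) loco-fixes)
    where
    X : List Block
    X = UB (suc n) i
    y : ℕ
    y = final x (copies (suc n) X)
    loco-fixes : move y (loco i) ≡ x
    loco-fixes = trans (sym (final-++ x (copies (suc n) X) [ loco i ])) fixed
    y≡x : y ≡ x
    y≡x = ℕP.≤-antisym (subst (y ≤_) loco-fixes (move-inflationary y (loco i)))
                       (final-inflationary x (copies (suc n) X))

  module Crossing (l e : ℕ) (2+l≤e : 2 ℕ.+ l ≤ e) (kstep-bounded : ∀ x → x ≤ l → kstep x ≤ l)
                  (r : ℕ) (r-least : IsLeast (joined l) r) where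

    data KNext (C : Set) : List Block → Set where
      none    : C → KNext C []
      startsK : ∀ Q → KNext C (copyK ∷ Q)

    Hit : ℕ → List Block → (List Block → Set) → Set
    Hit x bs T = ∃₂ λ P Q → bs ≡ P ++ loco r ∷ Q × final x P ≡ l × T Q

    Outcome : ℕ → List Block → (List Block → Set) → Set
    Outcome x bs T = final x bs ≤ l ⊎ Hit x bs T

    1≤e : 1 ≤ e
    1≤e = ℕP.≤-trans (s≤s z≤n) 2+l≤e

    e-large : ∀ x → ¬ (x ℕ.+ e ≤ suc l)
    e-large x x+e≤1+l = ℕP.<-irrefl refl (ℕP.≤-trans 2+l≤e (ℕP.≤-trans (ℕP.m≤n+m e x) x+e≤1+l))

    bounded⇒fixed : ∀ X x → final x (copies e X) ≤ l → final (final x (copies e X)) X ≡ final x (copies e X)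
    bounded⇒fixed X x bounded with copies-climb-or-fixed X x e
    ... | inj₁ climbed = ⊥-elim (e-large x (ℕP.≤-trans climbed (ℕP.≤-trans bounded (ℕP.n≤1+n l))))
    ... | inj₂ fixed   = fixed

    hit⇒beyond : ∀ {x bs T} → Hit x bs T → l < final x bs
    hit⇒beyond (P , Q , refl , at , _) = final-crossing P Q at (proj₁ r-least)

    -- A hit ending the last of n copies needs each earlier copy to advance the column
    -- (a fixed column stays fixed), whence x + n ≤ l + 1.
    copies-outcome : ∀ X → ∃[ X' ] X ≡ copyK ∷ X' → (∀ x → x ≤ l → Outcome x X (KNext ⊤)) →
                     ∀ n x → x ≤ l → Outcome x (copies n X) (KNext (x ℕ.+ n ≤ suc l))
    copies-outcome X _ _ zero x x≤l = inj₁ x≤l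
    copies-outcome X X-head outcome (suc n) x x≤l with outcome x x≤l
    ... | inj₂ (P , Q , split , at , next) =
          inj₂ (P , Q ++ copies n X , trans (cong (_++ copies n X) split) (ListP.++-assoc P (loco r ∷ Q) _) ,
                at , extend n next)
      where
      extend : ∀ n → KNext ⊤ Q → KNext (x ℕ.+ suc n ≤ suc l) (Q ++ copies n X)
      extend _       (startsK _) = startsK _
      extend zero    (none _)    = none (subst (_≤ suc l) (ℕP.+-comm 1 x) (s≤s x≤l))
      extend (suc n) (none _) =
        subst (KNext _) (cong (_++ copies n X) (sym (proj₂ X-head))) (startsK (proj₁ X-head ++ copies n X))
    ... | inj₁ Xx≤l with copies-outcome X X-head outcome n (final x X) Xx≤l
    ...   | inj₁ bounded = inj₁ (subst (_≤ l) (sym (final-++ x X (copies n X))) bounded)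
    ...   | inj₂ (P , Q , split , at , next) =
            inj₂ (X ++ P , Q , trans (cong (X ++_) split) (sym (ListP.++-assoc X P _)) ,
                  trans (final-++ x X P) at , weaken next)
      where
      x<Xx : x < final x X
      x<Xx with ℕP.m≤n⇒m<n∨m≡n (final-inflationary x X)
      ... | inj₁ advanced = advanced
      ... | inj₂ stalled  = ⊥-elim (ℕP.<⇒≱ (hit⇒beyond {T = KNext _} (P , Q , split , at , next))
              (subst (_≤ l) (sym (final-copies-fixed X _ (cong (λ w → final w X) (sym stalled)) n)) Xx≤l))
      weaken : KNext (final x X ℕ.+ n ≤ suc l) Q → KNext (x ℕ.+ suc n ≤ suc l) Q
      weaken (startsK Q')   = startsK Q'
      weaken (none climbed) =
        none (subst (_≤ suc l) (sym (ℕP.+-suc x n)) (ℕP.≤-trans (ℕP.+-monoˡ-≤ n x<Xx) climbed))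

    last-loco-outcome : ∀ j x → final x (copies e (UB e j)) ≤ l →
                        Outcome x (copies e (UB e j) ++ [ loco j ]) (KNext ⊤)
    last-loco-outcome j x y≤l
      with joined (final x (copies e (UB e j))) j in joined-yj | ℕP.m≤n⇒m<n∨m≡n y≤l
    ... | false | _ =
      inj₁ (subst (_≤ l) (sym (trans (final-++ x (copies e (UB e j)) [ loco j ]) (move-unjoined joined-yj))) y≤l)
    ... | true | inj₁ y<l =
      inj₁ (subst (_≤ l) (sym (trans (final-++ x (copies e (UB e j)) [ loco j ]) (move-joined joined-yj))) y<l)
    ... | true | inj₂ y≡l =
      inj₂ (copies e X , [] , cong (λ i → copies e X ++ [ loco i ]) j≡r , y≡l , none tt)
      where
      X : List Block
      X = UB e j
      l-fixed : final l X ≡ l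
      l-fixed = subst (λ z → final z X ≡ z) y≡l (bounded⇒fixed X x y≤l)
      j≡r : j ≡ r
      j≡r = least-unique (subst (λ z → joined z j ≡ true) y≡l joined-yj , fixed⇒unjoined 1≤e j l l-fixed)
                         r-least

    level-outcome : ∀ j x → x ≤ l → Outcome x (UB e j) (KNext ⊤)
    level-outcome zero    x x≤l = inj₁ (kstep-bounded x x≤l)
    level-outcome (suc j) x x≤l with copies-outcome (UB e j) (UB-head 1≤e j) (level-outcome j) e x x≤l
    ... | inj₁ y≤l = last-loco-outcome j x y≤l
    ... | inj₂ (_ , _ , _ , _ , none x+e≤1+l) = ⊥-elim (e-large x x+e≤1+l)
    ... | inj₂ (P , _ , split , at , startsK Q) =
          inj₂ (P , _ , trans (cong (_++ [ loco j ]) split) (ListP.++-assoc P _ _) ,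
                at , startsK (Q ++ [ loco j ]))

    SMEBlocks-split : ∀ a → (∀ x → x ≤ l → ∃[ j ] j ≤ 2 ℕ.* a × joined x j ≡ true) →
                      ∃₂ λ P Q → SMEBlocks a e ≡ P ++ loco r ∷ copyK ∷ Q × final 0 P ≡ l
    SMEBlocks-split a joins with copies-outcome (UB e (suc (2 ℕ.* a))) (UB-head 1≤e _) (level-outcome _) e 0 z≤n
    ... | inj₂ (P , _ , split , at , startsK Q)  = P , Q , split , at
    ... | inj₂ (_ , _ , _ , _ , none e≤1+l)      = ⊥-elim (e-large 0 e≤1+l)
    ... | inj₁ z≤l with joins _ z≤l
    ...   | j , j≤2a , joined-zj with trans (sym joined-zj)
                (fixed⇒unjoined 1≤e _ _ (bounded⇒fixed (UB e (suc (2 ℕ.* a))) 0 z≤l) j (s≤s j≤2a))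
    ...     | ()

module Robot (K : Algorithm) (B : Board) (nv : NoVerticalRemoved B)
  (K-ends-east : ∀ B' → NoVerticalRemoved B' →
                 ∃[ x ] (run B' (0ℤ , 0ℤ) K ≡ (x , 0ℤ) × 0ℤ ≤ℤ x)) where

  K-advances : ∀ x → ∃[ x' ] run B (+ x , 0ℤ) K ≡ (+ x' , 0ℤ) × x ≤ x'
  K-advances x with K-ends-east (shiftBoard (+ x) B) (λ u y → nv (u +ℤ + x) y)
  ... | + x' , ran , _     =
    x' ℕ.+ x , trans (run-shift B (+ x) (0ℤ , 0ℤ) K) (cong (shift (+ x)) ran) , ℕP.m≤n+m x x'
  ... | -[1+ _ ] , _ , ()

  kstep : ℕ → ℕ
  kstep x = proj₁ (K-advances x)

  kstep-inflationary : ∀ x → x ≤ kstep x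
  kstep-inflationary x = proj₂ (proj₂ (K-advances x))

  joined : ℕ → ℕ → Bool
  joined x j = hor B (+ x) (latitude j)

  open Dynamics kstep kstep-inflationary joined public

  joined-rank : ∀ {x y} → hor B (+ x) y ≡ true → joined x (rank y) ≡ true
  joined-rank {x} {y} = subst (λ z → hor B (+ x) z ≡ true) (sym (latitude-rank y))

  IsLeast⇒LeastJoin : ∀ {x r} → IsLeast (joined x) r → LeastJoin B (+ x) (latitude r)
  IsLeast⇒LeastJoin {r = r} r-least =
    proj₁ r-least ,
    λ y joined-y → subst (_≤ rank y) (sym (rank-latitude r)) (IsLeast⇒≤ r-least (joined-rank joined-y))

  joined-near-axis : ∀ {a x} → ∃[ y ] ((- (+ a) ≤ℤ y) × (y ≤ℤ + a) × hor B (+ x) y ≡ true) →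
                     ∃[ j ] j ≤ 2 ℕ.* a × joined x j ≡ true
  joined-near-axis {a} (y , -a≤y , y≤a , joined-y) =
    rank y , rank-≤ a y -a≤y y≤a , joined-rank joined-y

  run-block : ∀ x b → run B (+ x , 0ℤ) (expand K b) ≡ (+ move x b , 0ℤ)
  run-block x copyK    = proj₁ (proj₂ (K-advances x))
  run-block x (loco j) = trans (cong (run B (+ x , 0ℤ)) (Mloc≡NkESk j)) (run-NkESk B nv (latitude j) x)

  run-blocks : ∀ x bs → run B (+ x , 0ℤ) (concatMap (expand K) bs) ≡ (+ final x bs , 0ℤ)
  run-blocks x []       = refl
  run-blocks x (b ∷ bs) = trans (run-++ B (+ x , 0ℤ) (expand K b) (concatMap (expand K) bs))
    (trans (cong (λ p → run B p (concatMap (expand K) bs)) (run-block x b)) (run-blocks (move x b) bs))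

  steps-Mloc-joined : ∀ i x r → joined x r ≡ true →
    steps B (+ x , 0ℤ) (tag i (Mloc r)) ≡
      steps B (+ x , 0ℤ) (tag i (toLatitude (latitude r)))
        ++ (i , (+ x , latitude r) , (+ suc x , latitude r))
        ∷ steps B (+ suc x , latitude r) (tag i (fromLatitude (latitude r)))
  steps-Mloc-joined i x r joined-xr =
    subst (λ c → steps B (+ x , 0ℤ) (tag i (Mloc r)) ≡
                   steps B (+ x , 0ℤ) (tag i (toLatitude m))
                     ++ (i , (+ x , m) , (+ c , m)) ∷ steps B (+ c , m) (tag i (fromLatitude m)))
          (move-joined {x} {r} joined-xr)
          (trans (cong (λ is → steps B (+ x , 0ℤ) (tag i is)) (Mloc≡NkESk r)) (steps-NkESk B nv i m x))
    where
    m : ℤ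
    m = latitude r

  KStaysWithin : ℕ → Set
  KStaysWithin l = ∀ xv → xv ≤ l →
    ∃[ xw ] (run B (+ xv , 0ℤ) K ≡ (+ xw , 0ℤ) × xv ≤ xw × xw ≤ l)
      × All (λ p → proj₁ p ≤ℤ + l) (visited B (+ xv , 0ℤ) K)

  module Within (l : ℕ) (K-within : KStaysWithin l) where

    kstep-bounded : ∀ x → x ≤ l → kstep x ≤ l
    kstep-bounded x x≤l with K-within x x≤l
    ... | xw , (ran , _ , xw≤l) , _ =
      subst (_≤ l) (ℤP.+-injective (,-injectiveˡ (trans (sym ran) (proj₁ (proj₂ (K-advances x)))))) xw≤l

    arrives-within⇒¬Crosses : ∀ t → proj₁ (arrival t) ≤ℤ + l → ¬ Crosses (+ l) t
    arrives-within⇒¬Crosses _ within (_ , arrives) with subst (_≤ℤ + l) arrives within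
    ... | +≤+ l+1≤l = ℕP.<-irrefl refl (subst (_≤ l) (ℕP.+-comm l 1) l+1≤l)

    column-never-crosses : ∀ {x ts} → x ≤ l → All (ArrivesIn (+ x)) ts → All (λ t → ¬ Crosses (+ l) t) ts
    column-never-crosses x≤l =
      All-map (λ {t} arrives → arrives-within⇒¬Crosses t (subst (_≤ℤ + l) (sym arrives) (+≤+ x≤l)))

    block-never-crosses : ∀ i x b → x ≤ l → move x b ≤ l →
                          All (λ t → ¬ Crosses (+ l) t) (steps B (+ x , 0ℤ) (tag i (expand K b)))
    block-never-crosses i x copyK x≤l _ =
      All-map (λ {t} → arrives-within⇒¬Crosses t)
              (steps-visited B i (+ x , 0ℤ) K (proj₂ (proj₂ (K-within x x≤l))))
    block-never-crosses i x (loco j) x≤l east≤l rewrite Mloc≡NkESk j | steps-NkESk B nv i (latitude j) x =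
      ++⁺ (column-never-crosses x≤l (toLatitude-column B i m _))
          (arrives-within⇒¬Crosses (i , (+ x , m) , (+ east B x m , m)) (+≤+ east≤l)
           ∷ column-never-crosses east≤l (fromLatitude-column B i m _))
      where
      m : ℤ
      m = latitude j

    steps-never-cross : ∀ i x bs → final x bs ≤ l →
                        All (λ t → ¬ Crosses (+ l) t) (steps B (+ x , 0ℤ) (tagged K i bs))
    steps-never-cross i x []       _       = []
    steps-never-cross i x (b ∷ bs) bounded
      rewrite steps-++ B (+ x , 0ℤ) (tag i (expand K b)) (tagged K (suc i) bs)
            | map-proj₂-tag i (expand K b) | run-block x b =
      ++⁺ (block-never-crosses i x b (ℕP.≤-trans (final-inflationary x (b ∷ bs)) bounded)
                                     (ℕP.≤-trans (final-inflationary (move x b) bs) bounded))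
          (steps-never-cross (suc i) (move x b) bs bounded)

    first-crossing : ∀ r → joined l r ≡ true → ∀ P Q → final 0 P ≡ l →
      ∃[ pre ] ∃[ rest ]
        (steps B (0ℤ , 0ℤ) (tagged K 0 (P ++ loco r ∷ Q))
           ≡ pre ++ (length P , (+ l , latitude r) , (+ suc l , latitude r)) ∷ rest)
        × All (λ t → ¬ Crosses (+ l) t) pre
    first-crossing r joined-lr P Q at =
      S₁ ++ to , from ++ R , steps≡ ,
      ++⁺ (steps-never-cross 0 0 P (ℕP.≤-reflexive at))
          (column-never-crosses ℕP.≤-refl (toLatitude-column B L m _))
      where
      open ≡-Reasoning
      m : ℤ
      m = latitude r
      L : ℕ
      L = length P
      S₁ : List Step
      S₁ = steps B (0ℤ , 0ℤ) (tagged K 0 P)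
      to : List Step
      to = steps B (+ l , 0ℤ) (tag L (toLatitude m))
      from : List Step
      from = steps B (+ suc l , m) (tag L (fromLatitude m))
      R : List Step
      R = steps B (run B (+ l , 0ℤ) (map proj₂ (tag L (Mloc r)))) (tagged K (suc L) Q)
      at-column : run B (0ℤ , 0ℤ) (map proj₂ (tagged K 0 P)) ≡ (+ l , 0ℤ)
      at-column = trans (cong (run B (0ℤ , 0ℤ)) (map-proj₂-tagged K 0 P))
                        (trans (run-blocks 0 P) (cong (λ x → (+ x , 0ℤ)) at))
      steps≡ : steps B (0ℤ , 0ℤ) (tagged K 0 (P ++ loco r ∷ Q))
                 ≡ (S₁ ++ to) ++ (L , (+ l , m) , (+ suc l , m)) ∷ (from ++ R)
      steps≡ = begin
        steps B (0ℤ , 0ℤ) (tagged K 0 (P ++ loco r ∷ Q))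
          ≡⟨ cong (steps B (0ℤ , 0ℤ)) (tagged-++ K 0 P (loco r ∷ Q)) ⟩
        steps B (0ℤ , 0ℤ) (tagged K 0 P ++ tagged K L (loco r ∷ Q))
          ≡⟨ steps-++ B (0ℤ , 0ℤ) (tagged K 0 P) (tagged K L (loco r ∷ Q)) ⟩
        S₁ ++ steps B (run B (0ℤ , 0ℤ) (map proj₂ (tagged K 0 P))) (tagged K L (loco r ∷ Q))
          ≡⟨ cong (λ p → S₁ ++ steps B p (tagged K L (loco r ∷ Q))) at-column ⟩
        S₁ ++ steps B (+ l , 0ℤ) (tag L (Mloc r) ++ tagged K (suc L) Q)
          ≡⟨ cong (S₁ ++_) (steps-++ B (+ l , 0ℤ) (tag L (Mloc r)) (tagged K (suc L) Q)) ⟩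
        S₁ ++ (steps B (+ l , 0ℤ) (tag L (Mloc r)) ++ R)
          ≡⟨ cong (λ ss → S₁ ++ (ss ++ R)) (steps-Mloc-joined L l r joined-lr) ⟩
        S₁ ++ ((to ++ (L , (+ l , m) , (+ suc l , m)) ∷ from) ++ R)
          ≡⟨ cong (S₁ ++_) (ListP.++-assoc to _ R) ⟩
        S₁ ++ (to ++ (L , (+ l , m) , (+ suc l , m)) ∷ (from ++ R))
          ≡⟨ sym (ListP.++-assoc S₁ to _) ⟩
        (S₁ ++ to) ++ (L , (+ l , m) , (+ suc l , m)) ∷ (from ++ R) ∎

lemma4p1 : (a e : ℕ) → 1 ≤ a → 1 ≤ e → (K : Algorithm) →
  (∀ (B' : Board) → NoVerticalRemoved B' →
    ∃[ x ] (run B' (0ℤ , 0ℤ) K ≡ (x , 0ℤ) × 0ℤ ≤ℤ x)) →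
  (B : Board) → NoVerticalRemoved B →
  (l : ℕ) → 2 Data.Nat.+ l ≤ e →
  (∀ (x : ℕ) → x ≤ l →
    ∃[ y ] ((- (+ a) ≤ℤ y) × (y ≤ℤ + a) × hor B (+ x) y ≡ true)) →
  (∀ (xv : ℕ) → xv ≤ l →
    ∃[ xw ] (run B (+ xv , 0ℤ) K ≡ (+ xw , 0ℤ) × xv ≤ xw × xw ≤ l)
      × All (λ p → proj₁ p ≤ℤ + l) (visited B (+ xv , 0ℤ) K)) →
  (∃[ xv ] (run B (0ℤ , 0ℤ) (SME a e K) ≡ (xv , 0ℤ) × + suc l ≤ℤ xv))
  × (∃[ m ] LeastJoin B (+ l) m ×
      ∃[ pre ] ∃[ s ] ∃[ rest ]
        (steps B (0ℤ , 0ℤ) (tagged K 0 (SMEBlocks a e)) ≡ pre ++ s ∷ rest)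
        × All (λ t → ¬ Crosses (+ l) t) pre
        × Crosses (+ l) s
        × ∃[ j ] (nth (SMEBlocks a e) (proj₁ s) ≡ just (loco j) × Mloc j ≡ NkESk m)
        × nth (SMEBlocks a e) (suc (proj₁ s)) ≡ just copyK)
lemma4p1 a e _ _ K K-ends-east B nv l 2+l≤e joins K-within =
  let open Robot K B nv K-ends-east
      open Within l K-within
      (j , _ , joined-lj) = joined-near-axis (joins l ℕP.≤-refl)
      (r , r-least) = least-exists (joined l) j joined-lj
      open Crossing l e 2+l≤e kstep-bounded r r-least
      (P , Q , split , at) = SMEBlocks-split a (λ x x≤l → joined-near-axis (joins x x≤l))
      (pre , rest , steps≡ , no-crossing) = first-crossing r (proj₁ r-least) P (copyK ∷ Q) at
  in  (+ final 0 (SMEBlocks a e) , run-blocks 0 (SMEBlocks a e) ,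
       +≤+ (subst (λ bs → suc l ≤ final 0 bs) (sym split) (final-crossing P (copyK ∷ Q) at (proj₁ r-least))))
    , latitude r , IsLeast⇒LeastJoin r-least
    , pre , (length P , (+ l , latitude r) , (+ suc l , latitude r)) , rest
    , trans (cong (λ bs → steps B (0ℤ , 0ℤ) (tagged K 0 bs)) split) steps≡
    , no-crossing , (refl , cong +_ (ℕP.+-comm 1 l))
    , r , (trans (cong (λ bs → nth bs (length P)) split) (nth-++ʳ P _ 0) , Mloc≡NkESk r)
    , trans (cong (λ bs → nth bs (suc (length P))) split) (nth-++ʳ P _ 1)
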